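{- If $m$ and $n$ are even integers with $m,n\ge 4$, then there exists a shiftable integer Heffter array $H_s(m,n)$.
   Context: An integer Heffter array $H(m,n)$ is an $m\times n$ array with entries from $\{ -mn,\dots,mn\}$ such that every row and every column sums to $0$ over the integers and no element from any pair $\{x,-x\}$ appears twice, so the multiset of absolute values of the entries is exactly $\{1,\dots,mn\}$. It is shiftable, denoted $H_s(m,n)$, if each row and each column contains the same number of positive entries as negative entries. -}

module Defs where

open import Data.Nat using (ℕ; zero; suc; _*_)
import Data.Nat
import Data.Product
open import Data.Fin using (Fin)
import Data.Fin as F
open import Data.Integer using (ℤ; ∣_∣; _<_; 0ℤ) renaming (_+_ to _+ℤ_)
import Data.Integer as ℤ
open import Data.Product using (_×_; _,_)
open import Relation.Binary.PropositionalEquality using (_≡_)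
open import Relation.Nullary.Decidable using (does)
open import Data.Bool using (if_then_else_)
open import Function.Definitions using (Injective)

sumℤ : (n : ℕ) → (Fin n → ℤ) → ℤ
sumℤ zero    f = 0ℤ
sumℤ (suc n) f = f F.zero +ℤ sumℤ n (λ i → f (F.suc i))

#pos : (n : ℕ) → (Fin n → ℤ) → ℕ
#pos zero    f = zero
#pos (suc n) f = (if does (0ℤ ℤ.<? f F.zero) then suc else (λ k → k)) (#pos n (λ i → f (F.suc i)))

#neg : (n : ℕ) → (Fin n → ℤ) → ℕ
#neg zero    f = zero
#neg (suc n) f = (if does (f F.zero ℤ.<? 0ℤ) then suc else (λ k → k)) (#neg n (λ i → f (F.suc i)))

Array : ℕ → ℕ → Set
Array m n = Fin m → Fin n → ℤ

-- Integer Heffter array H(m,n): every row and column sums to 0 in ℤ, and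
-- the multiset of absolute values of the entries is exactly {1,…,mn}
-- (i.e. (i,j) ↦ |A i j| is injective with values in {1,…,mn}; since there are
-- mn cells this is a bijection onto {1,…,mn}).
record IsIntegerHeffter (m n : ℕ) (A : Array m n) : Set where
  field
    rowSum    : ∀ i → sumℤ n (λ j → A i j) ≡ 0ℤ
    colSum    : ∀ j → sumℤ m (λ i → A i j) ≡ 0ℤ
    absLower  : ∀ i j → 1 Data.Nat.≤ ∣ A i j ∣
    absUpper  : ∀ i j → ∣ A i j ∣ Data.Nat.≤ m * n
    absInj    : Injective _≡_ _≡_ (λ (p : Fin m × Fin n) → ∣ A (Data.Product.proj₁ p) (Data.Product.proj₂ p) ∣)

record IsShiftable (m n : ℕ) (A : Array m n) : Set where
  field
    rowBalanced : ∀ i → #pos n (λ j → A i j) ≡ #neg n (λ j → A i j)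
    colBalanced : ∀ j → #pos m (λ i → A i j) ≡ #neg m (λ i → A i j)

record ShiftableHeffter (m n : ℕ) : Set where
  field
    array     : Array m n
    heffter   : IsIntegerHeffter m n array
    shiftable : IsShiftable m n array

-- Shifting every entry of a shiftable H(m,n₂) away from zero by mn₁ (adding mn₁ to
-- positive entries, subtracting it from negative ones) keeps its row and column sums
-- zero, because each line has as many positive as negative entries, and moves its
-- absolute values from {1,…,mn₂} to {mn₁+1,…,m(n₁+n₂)}.  Placing the shifted array
-- next to a shiftable H(m,n₁) therefore gives a shiftable H(m,n₁+n₂), and by
-- transposition the same works vertically.  Every even number ≥ 4 is a sum of 4s and
-- 6s, so glueing copies of explicit arrays H_s(4,4), H_s(4,6), H_s(6,4), H_s(6,6)
-- yields every H_s(m,n) with m, n even and ≥ 4.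
module Submission where

open import Defs
open import Data.Bool using (Bool; true; false; if_then_else_)
open import Data.Empty using (⊥-elim)
open import Data.Fin using (Fin; zero; suc; _↑ˡ_; _↑ʳ_; splitAt; join)
import Data.Fin.Properties as Fin
open import Data.Integer using (ℤ; +_; -_; -[1+_]; +[1+_]; 0ℤ; ∣_∣; _<?_; _-_)
  renaming (_+_ to _+ℤ_; _*_ to _*ℤ_)
import Data.Integer.Properties as ℤ
open import Data.Integer.Solver using (module +-*-Solver)
open import Data.Nat as ℕ using (ℕ; suc; _+_; _*_; _≤_; _<_; z≤n; s≤s; _≤?_)
open import Data.Nat.Divisibility using (_∣_; divides)
import Data.Nat.Properties as ℕ
open import Data.Product using (_×_; _,_; proj₁; proj₂; swap)
import Data.Product.Properties as Product
open import Data.Sum using (_⊎_; inj₁; inj₂; [_,_]′)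
open import Data.Vec using (Vec; _∷_; []; lookup)
open import Function using (_∘_)
open import Function.Definitions using (Injective)
open import Relation.Binary.PropositionalEquality
  using (_≡_; refl; sym; trans; cong; cong₂; subst; module ≡-Reasoning)
open import Relation.Nullary.Decidable using (Dec; does; map′; _×-dec_; _→-dec_; True; toWitness)

open IsIntegerHeffter
open IsShiftable
open ShiftableHeffter

tally : Bool → ℕ → ℕ
tally b = if b then suc else (λ k → k)

tally-+ : ∀ b x y → tally b x + y ≡ tally b (x + y)
tally-+ true  x y = refl
tally-+ false x y = refl

sumℤ-cong : ∀ n {f g : Fin n → ℤ} → (∀ i → f i ≡ g i) → sumℤ n f ≡ sumℤ n g
sumℤ-cong ℕ.zero  eq = refl
sumℤ-cong (suc n) eq = cong₂ _+ℤ_ (eq zero) (sumℤ-cong n (eq ∘ suc))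

#pos-cong : ∀ n {f g : Fin n → ℤ} → (∀ i → f i ≡ g i) → #pos n f ≡ #pos n g
#pos-cong ℕ.zero  eq = refl
#pos-cong (suc n) eq =
  cong₂ (λ x → tally (does (0ℤ <? x))) (eq zero) (#pos-cong n (eq ∘ suc))

#neg-cong : ∀ n {f g : Fin n → ℤ} → (∀ i → f i ≡ g i) → #neg n f ≡ #neg n g
#neg-cong ℕ.zero  eq = refl
#neg-cong (suc n) eq =
  cong₂ (λ x → tally (does (x <? 0ℤ))) (eq zero) (#neg-cong n (eq ∘ suc))

sumℤ-++ : ∀ n₁ n₂ (f : Fin (n₁ + n₂) → ℤ) →
          sumℤ (n₁ + n₂) f ≡ sumℤ n₁ (f ∘ (_↑ˡ n₂)) +ℤ sumℤ n₂ (f ∘ (n₁ ↑ʳ_))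
sumℤ-++ ℕ.zero   n₂ f = sym (ℤ.+-identityˡ _)
sumℤ-++ (suc n₁) n₂ f =
  trans (cong (f zero +ℤ_) (sumℤ-++ n₁ n₂ (f ∘ suc))) (sym (ℤ.+-assoc (f zero) _ _))

#pos-++ : ∀ n₁ n₂ (f : Fin (n₁ + n₂) → ℤ) →
          #pos (n₁ + n₂) f ≡ #pos n₁ (f ∘ (_↑ˡ n₂)) + #pos n₂ (f ∘ (n₁ ↑ʳ_))
#pos-++ ℕ.zero   n₂ f = refl
#pos-++ (suc n₁) n₂ f =
  trans (cong (tally b) (#pos-++ n₁ n₂ (f ∘ suc))) (sym (tally-+ b _ _))
  where
    b : Bool
    b = does (0ℤ <? f zero)

#neg-++ : ∀ n₁ n₂ (f : Fin (n₁ + n₂) → ℤ) →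
          #neg (n₁ + n₂) f ≡ #neg n₁ (f ∘ (_↑ˡ n₂)) + #neg n₂ (f ∘ (n₁ ↑ʳ_))
#neg-++ ℕ.zero   n₂ f = refl
#neg-++ (suc n₁) n₂ f =
  trans (cong (tally b) (#neg-++ n₁ n₂ (f ∘ suc))) (sym (tally-+ b _ _))
  where
    b : Bool
    b = does (f zero <? 0ℤ)

shift : ℕ → ℤ → ℤ
shift c (+ k)    = + (k + c)
shift c -[1+ k ] = -[1+ k + c ]

∣shift∣ : ∀ c x → ∣ shift c x ∣ ≡ ∣ x ∣ + c
∣shift∣ c (+ k)    = refl
∣shift∣ c -[1+ k ] = refl

Nonzero : ∀ n → (Fin n → ℤ) → Set
Nonzero n f = ∀ i → 1 ≤ ∣ f i ∣

#pos-shift : ∀ n c (f : Fin n → ℤ) → Nonzero n f → #pos n (shift c ∘ f) ≡ #pos n f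
#pos-shift ℕ.zero  c f nz = refl
#pos-shift (suc n) c f nz with f zero | nz zero
... | +[1+ k ] | _ = cong suc (#pos-shift n c (f ∘ suc) (nz ∘ suc))
... | -[1+ k ] | _ = #pos-shift n c (f ∘ suc) (nz ∘ suc)

#neg-shift : ∀ n c (f : Fin n → ℤ) → Nonzero n f → #neg n (shift c ∘ f) ≡ #neg n f
#neg-shift ℕ.zero  c f nz = refl
#neg-shift (suc n) c f nz with f zero | nz zero
... | +[1+ k ] | _ = #neg-shift n c (f ∘ suc) (nz ∘ suc)
... | -[1+ k ] | _ = cong suc (#neg-shift n c (f ∘ suc) (nz ∘ suc))

-[1+k+c]≡-[1+k]-c : ∀ k c → -[1+ k + c ] ≡ -[1+ k ] - + c
-[1+k+c]≡-[1+k]-c k ℕ.zero  = cong -[1+_] (ℕ.+-identityʳ k)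
-[1+k+c]≡-[1+k]-c k (suc c) = cong -[1+_] (ℕ.+-suc k c)

sumℤ-shift : ∀ n c (f : Fin n → ℤ) → Nonzero n f →
             sumℤ n (shift c ∘ f) ≡ sumℤ n f +ℤ (+ #pos n f - + #neg n f) *ℤ + c
sumℤ-shift ℕ.zero  c f nz = refl
sumℤ-shift (suc n) c f nz with f zero | nz zero
... | +[1+ k ] | _ =
  trans (cong (+[1+ k ] +ℤ + c +ℤ_) (sumℤ-shift n c (f ∘ suc) (nz ∘ suc)))
        (solve 5 (λ x C S P Q → (x :+ C) :+ (S :+ (P :- Q) :* C)
                             := (x :+ S) :+ ((con (+ 1) :+ P) :- Q) :* C)
               refl +[1+ k ] (+ c) (sumℤ n (f ∘ suc)) (+ #pos n (f ∘ suc)) (+ #neg n (f ∘ suc)))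
  where open +-*-Solver
... | -[1+ k ] | _ =
  trans (cong₂ _+ℤ_ (-[1+k+c]≡-[1+k]-c k c) (sumℤ-shift n c (f ∘ suc) (nz ∘ suc)))
        (solve 5 (λ x C S P Q → (x :- C) :+ (S :+ (P :- Q) :* C)
                             := (x :+ S) :+ (P :- (con (+ 1) :+ Q)) :* C)
               refl -[1+ k ] (+ c) (sumℤ n (f ∘ suc)) (+ #pos n (f ∘ suc)) (+ #neg n (f ∘ suc)))
  where open +-*-Solver

sumℤ-shift-balanced : ∀ n c (f : Fin n → ℤ) → Nonzero n f →
                      sumℤ n f ≡ 0ℤ → #pos n f ≡ #neg n f → sumℤ n (shift c ∘ f) ≡ 0ℤ
sumℤ-shift-balanced n c f nz sum≡0 pos≡neg = begin
  sumℤ n (shift c ∘ f)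
    ≡⟨ sumℤ-shift n c f nz ⟩
  sumℤ n f +ℤ (+ #pos n f - + #neg n f) *ℤ + c
    ≡⟨ cong₂ (λ s p → s +ℤ (+ p - + #neg n f) *ℤ + c) sum≡0 pos≡neg ⟩
  0ℤ +ℤ (+ #neg n f - + #neg n f) *ℤ + c
    ≡⟨ cong (λ d → 0ℤ +ℤ d *ℤ + c) (ℤ.+-inverseʳ (+ #neg n f)) ⟩
  0ℤ ∎
  where open ≡-Reasoning

transpose : ∀ {m n} → ShiftableHeffter m n → ShiftableHeffter n m
transpose {m} {n} H = record
  { array     = λ j i → array H i j
  ; heffter   = record
    { rowSum   = colSum h
    ; colSum   = rowSum h
    ; absLower = λ j i → absLower h i j
    ; absUpper = λ j i → subst (∣ array H i j ∣ ≤_) (ℕ.*-comm m n) (absUpper h i j)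
    ; absInj   = λ {p} {q} e → cong swap (absInj h {swap p} {swap q} e) }
  ; shiftable = record
    { rowBalanced = colBalanced (shiftable H)
    ; colBalanced = rowBalanced (shiftable H) } }
  where
    h : IsIntegerHeffter m n (array H)
    h = heffter H

splitAt-injective : ∀ m {n} {i j : Fin (m + n)} → splitAt m i ≡ splitAt m j → i ≡ j
splitAt-injective m {n} {i} {j} eq = begin
  i                      ≡⟨ Fin.join-splitAt m n i ⟨
  join m n (splitAt m i) ≡⟨ cong (join m n) eq ⟩
  join m n (splitAt m j) ≡⟨ Fin.join-splitAt m n j ⟩
  j                      ∎
  where open ≡-Reasoning

module Beside {m n₁ n₂ : ℕ} (H₁ : ShiftableHeffter m n₁) (H₂ : ShiftableHeffter m n₂) where

  private
    h₁ : IsIntegerHeffter m n₁ (array H₁)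
    h₁ = heffter H₁
    h₂ : IsIntegerHeffter m n₂ (array H₂)
    h₂ = heffter H₂
    s₁ : IsShiftable m n₁ (array H₁)
    s₁ = shiftable H₁
    s₂ : IsShiftable m n₂ (array H₂)
    s₂ = shiftable H₂

  c : ℕ
  c = m * n₁

  cell : Fin m → Fin n₁ ⊎ Fin n₂ → ℤ
  cell i = [ array H₁ i , shift c ∘ array H₂ i ]′

  A : Array m (n₁ + n₂)
  A i = cell i ∘ splitAt n₁

  A-↑ˡ : ∀ i a → A i (a ↑ˡ n₂) ≡ array H₁ i a
  A-↑ˡ i a = cong (cell i) (Fin.splitAt-↑ˡ n₁ a n₂)

  A-↑ʳ : ∀ i b → A i (n₁ ↑ʳ b) ≡ shift c (array H₂ i b)
  A-↑ʳ i b = cong (cell i) (Fin.splitAt-↑ʳ n₁ n₂ b)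

  rowSum-A : ∀ i → sumℤ (n₁ + n₂) (A i) ≡ 0ℤ
  rowSum-A i = begin
    sumℤ (n₁ + n₂) (A i)
      ≡⟨ sumℤ-++ n₁ n₂ (A i) ⟩
    sumℤ n₁ (A i ∘ (_↑ˡ n₂)) +ℤ sumℤ n₂ (A i ∘ (n₁ ↑ʳ_))
      ≡⟨ cong₂ _+ℤ_ (sumℤ-cong n₁ (A-↑ˡ i)) (sumℤ-cong n₂ (A-↑ʳ i)) ⟩
    sumℤ n₁ (array H₁ i) +ℤ sumℤ n₂ (shift c ∘ array H₂ i)
      ≡⟨ cong₂ _+ℤ_ (rowSum h₁ i)
           (sumℤ-shift-balanced n₂ c _ (absLower h₂ i) (rowSum h₂ i) (rowBalanced s₂ i)) ⟩
    0ℤ ∎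
    where open ≡-Reasoning

  rowBalanced-A : ∀ i → #pos (n₁ + n₂) (A i) ≡ #neg (n₁ + n₂) (A i)
  rowBalanced-A i = begin
    #pos (n₁ + n₂) (A i)
      ≡⟨ #pos-++ n₁ n₂ (A i) ⟩
    #pos n₁ (A i ∘ (_↑ˡ n₂)) + #pos n₂ (A i ∘ (n₁ ↑ʳ_))
      ≡⟨ cong₂ _+_ (#pos-cong n₁ (A-↑ˡ i))
           (trans (#pos-cong n₂ (A-↑ʳ i)) (#pos-shift n₂ c _ (absLower h₂ i))) ⟩
    #pos n₁ (array H₁ i) + #pos n₂ (array H₂ i)
      ≡⟨ cong₂ _+_ (rowBalanced s₁ i) (rowBalanced s₂ i) ⟩
    #neg n₁ (array H₁ i) + #neg n₂ (array H₂ i)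
      ≡⟨ cong₂ _+_ (#neg-cong n₁ (A-↑ˡ i))
           (trans (#neg-cong n₂ (A-↑ʳ i)) (#neg-shift n₂ c _ (absLower h₂ i))) ⟨
    #neg n₁ (A i ∘ (_↑ˡ n₂)) + #neg n₂ (A i ∘ (n₁ ↑ʳ_))
      ≡⟨ #neg-++ n₁ n₂ (A i) ⟨
    #neg (n₁ + n₂) (A i) ∎
    where open ≡-Reasoning

  colSum-cell : ∀ s → sumℤ m (λ i → cell i s) ≡ 0ℤ
  colSum-cell (inj₁ a) = colSum h₁ a
  colSum-cell (inj₂ b) = sumℤ-shift-balanced m c _ (λ i → absLower h₂ i b)
                           (colSum h₂ b) (colBalanced s₂ b)

  colBalanced-cell : ∀ s → #pos m (λ i → cell i s) ≡ #neg m (λ i → cell i s)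
  colBalanced-cell (inj₁ a) = colBalanced s₁ a
  colBalanced-cell (inj₂ b) = begin
    #pos m (shift c ∘ (λ i → array H₂ i b)) ≡⟨ #pos-shift m c _ (λ i → absLower h₂ i b) ⟩
    #pos m (λ i → array H₂ i b)             ≡⟨ colBalanced s₂ b ⟩
    #neg m (λ i → array H₂ i b)             ≡⟨ #neg-shift m c _ (λ i → absLower h₂ i b) ⟨
    #neg m (shift c ∘ (λ i → array H₂ i b)) ∎
    where open ≡-Reasoning

  ∣cell∣-lower : ∀ i s → 1 ≤ ∣ cell i s ∣
  ∣cell∣-lower i (inj₁ a) = absLower h₁ i a
  ∣cell∣-lower i (inj₂ b) rewrite ∣shift∣ c (array H₂ i b) =
    ℕ.≤-trans (absLower h₂ i b) (ℕ.m≤m+n _ c)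

  ∣cell∣-upper : ∀ i s → ∣ cell i s ∣ ≤ m * (n₁ + n₂)
  ∣cell∣-upper i (inj₁ a) = ℕ.≤-trans (absUpper h₁ i a) (ℕ.*-monoʳ-≤ m (ℕ.m≤m+n n₁ n₂))
  ∣cell∣-upper i (inj₂ b) rewrite ∣shift∣ c (array H₂ i b) | ℕ.*-distribˡ-+ m n₁ n₂ =
    subst (∣ array H₂ i b ∣ + c ≤_) (ℕ.+-comm (m * n₂) c) (ℕ.+-monoˡ-≤ c (absUpper h₂ i b))

  ∣left∣<∣right∣ : ∀ i a i′ b → ∣ cell i (inj₁ a) ∣ < ∣ cell i′ (inj₂ b) ∣
  ∣left∣<∣right∣ i a i′ b rewrite ∣shift∣ c (array H₂ i′ b) =
    ℕ.≤-trans (s≤s (absUpper h₁ i a)) (ℕ.+-monoˡ-≤ c (absLower h₂ i′ b))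

  ∣cell∣-injective : ∀ i i′ s s′ → ∣ cell i s ∣ ≡ ∣ cell i′ s′ ∣ → (i , s) ≡ (i′ , s′)
  ∣cell∣-injective i i′ (inj₁ a) (inj₁ a′) eq = cong (λ (k , l) → k , inj₁ l) (absInj h₁ eq)
  ∣cell∣-injective i i′ (inj₂ b) (inj₂ b′) eq
    rewrite ∣shift∣ c (array H₂ i b) | ∣shift∣ c (array H₂ i′ b′) =
    cong (λ (k , l) → k , inj₂ l) (absInj h₂ (ℕ.+-cancelʳ-≡ _ _ _ eq))
  ∣cell∣-injective i i′ (inj₁ a) (inj₂ b′) eq = ⊥-elim (ℕ.<⇒≢ (∣left∣<∣right∣ i a i′ b′) eq)
  ∣cell∣-injective i i′ (inj₂ b) (inj₁ a′) eq = ⊥-elim (ℕ.<⇒≢ (∣left∣<∣right∣ i′ a′ i b) (sym eq))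

  ∣A∣-injective : Injective _≡_ _≡_ (λ (p : Fin m × Fin (n₁ + n₂)) → ∣ A (proj₁ p) (proj₂ p) ∣)
  ∣A∣-injective {i , j} {i′ , j′} eq
    with i≡i′ , sj≡sj′ ← Product.,-injective (∣cell∣-injective i i′ (splitAt n₁ j) (splitAt n₁ j′) eq)
    = cong₂ _,_ i≡i′ (splitAt-injective n₁ sj≡sj′)

  beside : ShiftableHeffter m (n₁ + n₂)
  beside = record
    { array     = A
    ; heffter   = record
      { rowSum   = rowSum-A
      ; colSum   = colSum-cell ∘ splitAt n₁
      ; absLower = λ i → ∣cell∣-lower i ∘ splitAt n₁
      ; absUpper = λ i → ∣cell∣-upper i ∘ splitAt n₁
      ; absInj   = ∣A∣-injective }
    ; shiftable = record
      { rowBalanced = rowBalanced-A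
      ; colBalanced = colBalanced-cell ∘ splitAt n₁ } }

open Beside using (beside)

above : ∀ {m₁ m₂ n} → ShiftableHeffter m₁ n → ShiftableHeffter m₂ n → ShiftableHeffter (m₁ + m₂) n
above H₁ H₂ = transpose (beside (transpose H₁) (transpose H₂))

allCells? : ∀ {m n} {P : Fin m × Fin n → Set} → (∀ p → Dec (P p)) → Dec (∀ p → P p)
allCells? P? = map′ (λ all (i , j) → all i j) (λ all i j → all (i , j))
                    (Fin.all? λ i → Fin.all? λ j → P? (i , j))

isIntegerHeffter? : ∀ {m n} (A : Array m n) → Dec (IsIntegerHeffter m n A)
isIntegerHeffter? {m} {n} A = map′
  (λ (rs , cs , lo , up , inj) → record
     { rowSum = rs ; colSum = cs ; absLower = lo ; absUpper = up ; absInj = λ {p} {q} → inj p q })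
  (λ H → rowSum H , colSum H , absLower H , absUpper H , (λ p q → absInj H))
  (    Fin.all? (λ i → sumℤ n (A i) ℤ.≟ 0ℤ)
  ×-dec Fin.all? (λ j → sumℤ m (λ i → A i j) ℤ.≟ 0ℤ)
  ×-dec Fin.all? (λ i → Fin.all? λ j → 1 ≤? ∣ A i j ∣)
  ×-dec Fin.all? (λ i → Fin.all? λ j → ∣ A i j ∣ ≤? m * n)
  ×-dec allCells? (λ p → allCells? λ q → (∣A∣ p ℕ.≟ ∣A∣ q) →-dec Product.≡-dec Fin._≟_ Fin._≟_ p q))
  where
    ∣A∣ : Fin m × Fin n → ℕ
    ∣A∣ (i , j) = ∣ A i j ∣

isShiftable? : ∀ {m n} (A : Array m n) → Dec (IsShiftable m n A)
isShiftable? {m} {n} A = map′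
  (λ (rb , cb) → record { rowBalanced = rb ; colBalanced = cb })
  (λ S → rowBalanced S , colBalanced S)
  (      Fin.all? (λ i → #pos n (A i) ℕ.≟ #neg n (A i))
   ×-dec Fin.all? (λ j → #pos m (λ i → A i j) ℕ.≟ #neg m (λ i → A i j)))

fromRows : ∀ {m n} → Vec (Vec ℤ n) m → Array m n
fromRows rows i j = lookup (lookup rows i) j

byDecision : ∀ {m n} (A : Array m n) → {True (isIntegerHeffter? A)} → {True (isShiftable? A)} →
          ShiftableHeffter m n
byDecision A {h} {s} = record { array = A ; heffter = toWitness h ; shiftable = toWitness s }

H₄₄ : ShiftableHeffter 4 4
H₄₄ = byDecision (fromRows
  ( (   + 5 ∷ - + 13 ∷   + 10 ∷  - + 2 ∷ [])
  ∷ ( - + 1 ∷    + 3 ∷  - + 8 ∷    + 6 ∷ [])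
  ∷ (  + 12 ∷  - + 4 ∷    + 7 ∷ - + 15 ∷ [])
  ∷ (- + 16 ∷   + 14 ∷  - + 9 ∷   + 11 ∷ [])
  ∷ []))

H₄₆ : ShiftableHeffter 4 6
H₄₆ = byDecision (fromRows
  ( (  + 13 ∷ - + 19 ∷   + 24 ∷ - + 22 ∷   + 11 ∷  - + 7 ∷ [])
  ∷ ( - + 9 ∷   + 15 ∷ - + 23 ∷   + 20 ∷  - + 5 ∷    + 2 ∷ [])
  ∷ (   + 4 ∷ - + 10 ∷   + 17 ∷  - + 1 ∷    + 6 ∷ - + 16 ∷ [])
  ∷ ( - + 8 ∷   + 14 ∷ - + 18 ∷    + 3 ∷ - + 12 ∷   + 21 ∷ [])
  ∷ []))

H₆₆ : ShiftableHeffter 6 6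
H₆₆ = byDecision (fromRows
  ( (- + 12 ∷  - + 8 ∷   + 14 ∷ - + 25 ∷   + 26 ∷    + 5 ∷ [])
  ∷ (- + 31 ∷   + 32 ∷ - + 36 ∷   + 22 ∷  - + 7 ∷   + 20 ∷ [])
  ∷ (- + 34 ∷    + 9 ∷   + 13 ∷  - + 3 ∷   + 19 ∷  - + 4 ∷ [])
  ∷ (  + 15 ∷   + 21 ∷  - + 2 ∷   + 28 ∷ - + 33 ∷ - + 29 ∷ [])
  ∷ (  + 35 ∷ - + 30 ∷   + 17 ∷ - + 23 ∷   + 11 ∷ - + 10 ∷ [])
  ∷ (  + 27 ∷ - + 24 ∷  - + 6 ∷    + 1 ∷ - + 16 ∷   + 18 ∷ [])
  ∷ []))

sum-of-4s-and-6s-elim : (P : ℕ → Set) → P 4 → P 6 → (∀ {x y} → P x → P y → P (x + y)) →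
                        ∀ {m} → 2 ∣ m → 4 ≤ m → P m
sum-of-4s-and-6s-elim P p₄ p₆ _∙_ (divides q refl) 4≤m = go q 4≤m
  where
    go : ∀ q → 4 ≤ q * 2 → P (q * 2)
    go 1 (s≤s (s≤s ()))
    go 2 _ = p₄
    go 3 _ = p₆
    go (suc (suc (suc (suc r)))) _ = p₄ ∙ go (suc (suc r)) (s≤s (s≤s (s≤s (s≤s z≤n))))

theorem4 : (m n : ℕ) → 2 ∣ m → 2 ∣ n → 4 ≤ m → 4 ≤ n → ShiftableHeffter m n
theorem4 m n 2∣m 2∣n 4≤m 4≤n =
  sum-of-4s-and-6s-elim (ShiftableHeffter m) (stack H₄₄ H₆₄) (stack H₄₆ H₆₆) beside 2∣n 4≤n
  where
    H₆₄ : ShiftableHeffter 6 4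
    H₆₄ = transpose H₄₆

    stack : ∀ {k} → ShiftableHeffter 4 k → ShiftableHeffter 6 k → ShiftableHeffter m k
    stack H₄ H₆ = sum-of-4s-and-6s-elim (λ m′ → ShiftableHeffter m′ _) H₄ H₆ above 2∣m 4≤m
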